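{- Let $F$ be a DQBF in prenex CNF and let $\varphi,\psi$ be autarkies for $F$. Then the composition of $\varphi$ and $\psi$ — the partial assignment whose domain is the union of the domains of $\varphi$ and $\psi$, which assigns to each variable in the domain of $\psi$ the value assigned by $\psi$, and to each other variable in the domain of $\varphi$ the value assigned by $\varphi$ — is again an autarky for $F$.
   Context: A DQBF (dependency quantified Boolean formula) in CNF has the form $\forall x_1,\dots,x_n\,\exists y_1(D_1)\cdots\exists y_m(D_m): F_0$, where the $x_i$ are universal variables, the $y_j$ are existential variables, each dependency set $D_j\subseteq\{x_1,\dots,x_n\}$, and the matrix $F_0$ is a set of clauses over these variables. An autarky for $F$ is a partial assignment $\varphi$ to the existential variables which assigns to each variable $y_j$ in its domain a Boolean function of the universal variables in $D_j$, such that every clause of $F_0$ touched by $\varphi$ (i.e. containing a variable in the domain of $\varphi$) becomes a tautology (true under all assignments of the remaining variables) after substituting the assigned functions for the assigned variables. -}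

module Defs where

open import Data.Nat using (ℕ)
open import Data.Fin using (Fin)
open import Data.Bool using (Bool; true; false; not)
open import Data.Maybe using (Maybe; just; nothing)
open import Data.List using (List)
open import Data.Bool.ListAction using (any)
open import Data.List.Relation.Unary.All using (All)
open import Data.List.Relation.Unary.Any using (Any)
open import Data.Product using (_×_; ∃)
open import Relation.Binary.PropositionalEquality using (_≡_)

-- A DQBF  ∀ x₁…xₙ ∃ y₁(D₁)…∃ yₘ(Dₘ) : F₀  with n universal and m existential variables.

data Var (n m : ℕ) : Set where
  uvar : Fin n → Var n m
  evar : Fin m → Var n m

record Lit (n m : ℕ) : Set where
  constructor lit
  field
    var      : Var n m
    polarity : Bool
open Lit public

Clause : ℕ → ℕ → Set
Clause n m = List (Lit n m)

record DQBF (n m : ℕ) : Set₁ where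
  field
    Dep    : Fin m → Fin n → Set
    matrix : List (Clause n m)
open DQBF public

UAssign : ℕ → Set
UAssign n = Fin n → Bool

DependsOnlyOn : {n : ℕ} → (Fin n → Set) → (UAssign n → Bool) → Set
DependsOnlyOn {n} D f =
  (α β : UAssign n) → ((i : Fin n) → D i → α i ≡ β i) → f α ≡ f β

-- A partial assignment of Boolean functions (of the universals) to existentials;
-- nothing = variable not in the domain.
PartialAssign : ℕ → ℕ → Set
PartialAssign n m = Fin m → Maybe (UAssign n → Bool)

-- Value of a variable under universal assignment α, a total assignment τ of
-- the existentials not in the domain of φ, with φ's functions substituted.
varVal : {n m : ℕ} → PartialAssign n m → UAssign n → (Fin m → Bool) → Var n m → Bool
varVal φ α τ (uvar i) = α i
varVal φ α τ (evar j) with φ j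
... | just f  = f α
... | nothing = τ j

litVal : {n m : ℕ} → PartialAssign n m → UAssign n → (Fin m → Bool) → Lit n m → Bool
litVal φ α τ (lit v true)  = varVal φ α τ v
litVal φ α τ (lit v false) = not (varVal φ α τ v)

InDomain : {n m : ℕ} → PartialAssign n m → Fin m → Set
InDomain φ j = ∃ λ f → φ j ≡ just f

Touches : {n m : ℕ} → PartialAssign n m → Clause n m → Set
Touches φ C = Any (λ l → ∃ λ j → var l ≡ evar j × InDomain φ j) C

TautAfter : {n m : ℕ} → PartialAssign n m → Clause n m → Set
TautAfter {n} {m} φ C =
  (α : UAssign n) (τ : Fin m → Bool) → any (litVal φ α τ) C ≡ true

IsAutarky : {n m : ℕ} → DQBF n m → PartialAssign n m → Set
IsAutarky {n} {m} F φ =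
  ((j : Fin m) (f : UAssign n → Bool) → φ j ≡ just f → DependsOnlyOn (Dep F j) f)
  × All (λ C → Touches φ C → TautAfter φ C) (matrix F)

compose : {n m : ℕ} → PartialAssign n m → PartialAssign n m → PartialAssign n m
compose φ ψ j with ψ j
... | just g  = just g
... | nothing = φ j

module Submission where

open import Defs
open import Data.Nat using (ℕ)
open import Data.Fin using (Fin)
open import Data.Bool using (Bool; true; false; not)
open import Data.Bool.ListAction using (any; or)
open import Data.Maybe using (just; nothing)
open import Data.List using (List)
open import Data.List.Properties using (map-cong-local)
open import Data.List.Relation.Unary.All as All using (All)
open import Data.List.Relation.Unary.All.Properties using (¬Any⇒All¬)
open import Data.List.Relation.Unary.Any as Any using (any?)
open import Data.List.Relation.Unary.Any.Properties using (Any-⊎⁻)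
open import Data.Product using (_×_; ∃; _,_)
open import Data.Sum using (_⊎_; inj₁; inj₂)
open import Relation.Nullary using (¬_; Dec; yes; no; contradiction)
open import Relation.Binary.PropositionalEquality using (_≡_; refl; sym; cong; trans)

-- Evaluating under compose φ ψ is evaluating under ψ with the existentials left
-- free by ψ valued by φ.  Hence a clause touched by ψ stays a tautology, being
-- one under ψ for every valuation of its free existentials; a clause not touched
-- by ψ evaluates under compose φ ψ exactly as under φ, and then it must be
-- touched by φ.

any-cong : {A : Set} {f g : A → Bool} (xs : List A) →
           All (λ x → f x ≡ g x) xs → any f xs ≡ any g xs
any-cong xs eqs = cong or (map-cong-local eqs)

module _ {n m : ℕ} where

  TouchedBy : PartialAssign n m → Lit n m → Set
  TouchedBy ψ l = ∃ λ j → var l ≡ evar j × InDomain ψ j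

  touchedBy? : (ψ : PartialAssign n m) (l : Lit n m) → Dec (TouchedBy ψ l)
  touchedBy? ψ (lit (uvar i) p) = no λ { (_ , () , _) }
  touchedBy? ψ (lit (evar j) p) with ψ j in ψj
  ... | just f  = yes (j , refl , f , ψj)
  ... | nothing = no λ { (_ , refl , f , ψj′) → nothing≢just (trans (sym ψj) ψj′) }
    where
    nothing≢just : ∀ {f} → ¬ nothing ≡ just f
    nothing≢just ()

  touches? : (ψ : PartialAssign n m) (C : Clause n m) → Dec (Touches ψ C)
  touches? ψ = any? (touchedBy? ψ)

  compose-just⁻ : (φ ψ : PartialAssign n m) {j : Fin m} {f : UAssign n → Bool} →
                  compose φ ψ j ≡ just f → ψ j ≡ just f ⊎ φ j ≡ just f
  compose-just⁻ φ ψ {j} with ψ j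
  ... | just g  = inj₁
  ... | nothing = inj₂

  compose-touchedBy⁻ : (φ ψ : PartialAssign n m) {l : Lit n m} →
                       TouchedBy (compose φ ψ) l → TouchedBy ψ l ⊎ TouchedBy φ l
  compose-touchedBy⁻ φ ψ (j , l≡j , f , eq) with compose-just⁻ φ ψ eq
  ... | inj₁ ψj = inj₁ (j , l≡j , f , ψj)
  ... | inj₂ φj = inj₂ (j , l≡j , f , φj)

  compose-touches⁻ : (φ ψ : PartialAssign n m) {C : Clause n m} →
                     Touches (compose φ ψ) C → Touches ψ C ⊎ Touches φ C
  compose-touches⁻ φ ψ t = Any-⊎⁻ (Any.map (λ {l} → compose-touchedBy⁻ φ ψ {l}) t)

  evarVals : PartialAssign n m → UAssign n → (Fin m → Bool) → Fin m → Bool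
  evarVals φ α τ j = varVal φ α τ (evar j)

  varVal-compose : (φ ψ : PartialAssign n m) (α : UAssign n) (τ : Fin m → Bool) (v : Var n m) →
                   varVal (compose φ ψ) α τ v ≡ varVal ψ α (evarVals φ α τ) v
  varVal-compose φ ψ α τ (uvar i) = refl
  varVal-compose φ ψ α τ (evar j) with ψ j
  ... | just g  = refl
  ... | nothing = refl

  varVal-untouched : (φ ψ : PartialAssign n m) (α : UAssign n) (τ : Fin m → Bool) (l : Lit n m) →
                     ¬ TouchedBy ψ l → varVal ψ α (evarVals φ α τ) (var l) ≡ varVal φ α τ (var l)
  varVal-untouched φ ψ α τ (lit (uvar i) p) _ = refl
  varVal-untouched φ ψ α τ (lit (evar j) p) ¬t with ψ j in ψj
  ... | just f  = contradiction (j , refl , f , ψj) ¬t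
  ... | nothing = refl

  litVal-cong : {φ φ′ : PartialAssign n m} {α : UAssign n} {τ τ′ : Fin m → Bool} (l : Lit n m) →
                varVal φ α τ (var l) ≡ varVal φ′ α τ′ (var l) → litVal φ α τ l ≡ litVal φ′ α τ′ l
  litVal-cong (lit v true)  eq = eq
  litVal-cong (lit v false) eq = cong not eq

  tautAfter-compose-touched : (φ ψ : PartialAssign n m) (C : Clause n m) →
                              TautAfter ψ C → TautAfter (compose φ ψ) C
  tautAfter-compose-touched φ ψ C taut α τ =
    trans (any-cong C (All.tabulate λ {l} _ → litVal-cong l (varVal-compose φ ψ α τ (var l))))
          (taut α (evarVals φ α τ))

  tautAfter-compose-untouched : (φ ψ : PartialAssign n m) (C : Clause n m) →
                                ¬ Touches ψ C → TautAfter φ C → TautAfter (compose φ ψ) C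
  tautAfter-compose-untouched φ ψ C ¬t taut α τ =
    trans (any-cong C (All.map (λ {l} → agree l) (¬Any⇒All¬ C ¬t))) (taut α τ)
    where
    agree : ∀ l → ¬ TouchedBy ψ l → litVal (compose φ ψ) α τ l ≡ litVal φ α τ l
    agree l ¬tl = litVal-cong l (trans (varVal-compose φ ψ α τ (var l)) (varVal-untouched φ ψ α τ l ¬tl))

  compose-clause : (φ ψ : PartialAssign n m) (C : Clause n m) →
                   (Touches φ C → TautAfter φ C) → (Touches ψ C → TautAfter ψ C) →
                   Touches (compose φ ψ) C → TautAfter (compose φ ψ) C
  compose-clause φ ψ C hφ hψ t with touches? ψ C | compose-touches⁻ φ ψ t
  ... | yes tψ | _        = tautAfter-compose-touched φ ψ C (hψ tψ)
  ... | no ¬tψ | inj₁ tψ  = contradiction tψ ¬tψ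
  ... | no ¬tψ | inj₂ tφ  = tautAfter-compose-untouched φ ψ C ¬tψ (hφ tφ)

lemma3 : {n m : ℕ} (F : DQBF n m) (φ ψ : PartialAssign n m) →
         IsAutarky F φ → IsAutarky F ψ → IsAutarky F (compose φ ψ)
lemma3 F φ ψ (depφ , tautφ) (depψ , tautψ) =
  dep , All.zipWith (λ { {C} (hφ , hψ) → compose-clause φ ψ C hφ hψ }) (tautφ , tautψ)
  where
  dep : ∀ j f → compose φ ψ j ≡ just f → DependsOnlyOn (Dep F j) f
  dep j f eq with compose-just⁻ φ ψ eq
  ... | inj₁ ψj = depψ j f ψj
  ... | inj₂ φj = depφ j f φj
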